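{- Let $G^{\ast}$ be a $C_{5}^{+}$-free graph, let $u^{\ast}\in V(G^{\ast})$, and let $L$ be a connected component of the induced subgraph $G^{\ast}[N(u^{\ast})]$. Then $L$ is one of the following: (i) a star $K_{1,r}$ for some $r\geq 0$ (where $K_{1,0}$ is a single vertex); (ii) a double star $D_{a,b}$ for some $a,b\geq 1$; (iii) a copy of $S_{r+1}^{1}$ for some $r\geq 2$ (where $S_{3}^{1}$ is a triangle); (iv) a graph containing $C_{4}$ as a spanning subgraph, that is, $C_{4}$, $C_{3}^{+}$ or $K_{4}$.
   Context: All graphs are finite, simple and undirected. $N(u)$ is the neighborhood of $u$ and $G[S]$ is the subgraph induced by $S$. $C_{t}^{+}$ denotes the graph obtained from the cycle $C_t$ and a triangle $C_3$ by identifying an edge of each (so $C_3^+$ is $K_4$ minus an edge). A graph is $F$-free if it has no subgraph isomorphic to $F$. $S_{n}^{1}$ is the graph obtained from the star $K_{1,n-1}$ by adding one edge between two of its leaves. The double star $D_{a,b}$ is the tree consisting of two adjacent vertices, one of which has $a$ further pendant neighbors and the other $b$ further pendant neighbors. -}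

module Defs where

open import Data.Nat using (ℕ; zero; suc)
open import Data.Fin using (Fin; zero; suc; toℕ)
open import Data.Unit using (⊤; tt)
open import Data.Empty using (⊥)
open import Data.Sum using (_⊎_; inj₁; inj₂)
open import Data.Product using (Σ; _×_; _,_; ∃)
open import Relation.Nullary using (¬_; Dec)
open import Relation.Binary.PropositionalEquality using (_≡_; _≢_)

record Graph (n : ℕ) : Set₁ where
  field
    _~_    : Fin n → Fin n → Set
    ~-dec  : ∀ u v → Dec (u ~ v)
    ~-sym  : ∀ {u v} → u ~ v → v ~ u
    ~-irr  : ∀ {u} → ¬ (u ~ u)
open Graph public

VSet : ℕ → Set₁
VSet n = Fin n → Set

Nbhd : ∀ {n} → Graph n → Fin n → VSet n
Nbhd G u v = _~_ G u v

data ReachIn {n} (G : Graph n) (S : VSet n) (x : Fin n) : Fin n → Set where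
  here : S x → ReachIn G S x x
  step : ∀ {y z} → ReachIn G S x y → _~_ G y z → S z → ReachIn G S x z

IsComponent : ∀ {n} → Graph n → VSet n → VSet n → Set
IsComponent G S L =
  Σ (Fin _) (λ v → L v)
  × (∀ v → L v → S v)
  × (∀ x y → L x → L y → ReachIn G S x y)
  × (∀ x y → L x → S y → _~_ G x y → L y)

InducedIso : ∀ {n} → Graph n → VSet n → (V : Set) → (V → V → Set) → Set
InducedIso G L V H =
  Σ (V → Fin _) λ φ →
      (∀ {x y} → φ x ≡ φ y → x ≡ y)
    × (∀ x → L (φ x))
    × (∀ v → L v → ∃ λ x → φ x ≡ v)
    × (∀ x y → (_~_ G (φ x) (φ y) → H x y) × (H x y → _~_ G (φ x) (φ y)))

-- Star K_{1,r}: centre inj₁ tt, leaves inj₂ i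
StarAdj : (r : ℕ) → (⊤ ⊎ Fin r) → (⊤ ⊎ Fin r) → Set
StarAdj r (inj₁ _) (inj₂ _) = ⊤
StarAdj r (inj₂ _) (inj₁ _) = ⊤
StarAdj r _        _        = ⊥

data DSV (a b : ℕ) : Set where
  c₁ c₂ : DSV a b
  l₁ : Fin a → DSV a b
  l₂ : Fin b → DSV a b

DSAdj : (a b : ℕ) → DSV a b → DSV a b → Set
DSAdj a b c₁ c₂ = ⊤
DSAdj a b c₂ c₁ = ⊤
DSAdj a b c₁ (l₁ _) = ⊤
DSAdj a b (l₁ _) c₁ = ⊤
DSAdj a b c₂ (l₂ _) = ⊤
DSAdj a b (l₂ _) c₂ = ⊤
DSAdj a b _ _ = ⊥

-- S^1_{r+1}: star K_{1,r} plus the edge between leaves 0 and 1 (used with r ≥ 2)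
S1Adj : (r : ℕ) → (⊤ ⊎ Fin r) → (⊤ ⊎ Fin r) → Set
S1Adj r (inj₁ _) (inj₂ _) = ⊤
S1Adj r (inj₂ _) (inj₁ _) = ⊤
S1Adj r (inj₁ _) (inj₁ _) = ⊥
S1Adj r (inj₂ i) (inj₂ j) =
  (toℕ i ≡ 0 × toℕ j ≡ 1) ⊎ (toℕ i ≡ 1 × toℕ j ≡ 0)

-- Edge of the 4-cycle 0-1-2-3-0 (one orientation)
C4Edge : Fin 4 → Fin 4 → Set
C4Edge zero (suc zero) = ⊤
C4Edge (suc zero) (suc (suc zero)) = ⊤
C4Edge (suc (suc zero)) (suc (suc (suc zero))) = ⊤
C4Edge (suc (suc (suc zero))) zero = ⊤
C4Edge _ _ = ⊥

C4Adj : Fin 4 → Fin 4 → Set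
C4Adj i j = C4Edge i j ⊎ C4Edge j i

-- C_3^+ = K_4 minus the edge {0,2}: the 4-cycle plus chord {1,3}
C3⁺Adj : Fin 4 → Fin 4 → Set
C3⁺Adj i j = C4Adj i j ⊎ ((i ≡ suc zero × j ≡ suc (suc (suc zero)))
                        ⊎ (i ≡ suc (suc (suc zero)) × j ≡ suc zero))

K4Adj : Fin 4 → Fin 4 → Set
K4Adj i j = i ≢ j

-- C_5^+: 5-cycle 0-1-2-3-4-0 plus a triangle 0-1-5 on the edge {0,1}
C5⁺Edge : Fin 6 → Fin 6 → Set
C5⁺Edge zero (suc zero) = ⊤
C5⁺Edge (suc zero) (suc (suc zero)) = ⊤
C5⁺Edge (suc (suc zero)) (suc (suc (suc zero))) = ⊤
C5⁺Edge (suc (suc (suc zero))) (suc (suc (suc (suc zero)))) = ⊤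
C5⁺Edge (suc (suc (suc (suc zero)))) zero = ⊤
C5⁺Edge (suc (suc (suc (suc (suc zero))))) zero = ⊤
C5⁺Edge (suc (suc (suc (suc (suc zero))))) (suc zero) = ⊤
C5⁺Edge _ _ = ⊥

-- G contains C_5^+ as a (not necessarily induced) subgraph
HasC5⁺ : ∀ {n} → Graph n → Set
HasC5⁺ {n} G =
  Σ (Fin 6 → Fin n) λ f →
      (∀ {x y} → f x ≡ f y → x ≡ y)
    × (∀ i j → C5⁺Edge i j → _~_ G (f i) (f j))

C5⁺Free : ∀ {n} → Graph n → Set
C5⁺Free G = ¬ HasC5⁺ G

{-# OPTIONS --safe #-}
module Submission where

-- A path a b c d e inside N(u) yields a C₅⁺: u closes b c d e into a 5-cycle and a is
-- adjacent to both u and b. Hence a component L of G[N(u)] is connected and has no path on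
-- five vertices. A 4-cycle in such a graph spans it, since any further vertex attached to the
-- cycle would start a path on five vertices; its chords then decide between C₄, C₃⁺ and K₄.
-- Without 4-cycles, a vertex adjacent to all others makes L a star with at most one edge
-- between leaves (a second such edge, or a leaf next to one of its ends, gives a P₅ or a C₄).
-- If no vertex dominates, the middle edge of any path on four vertices dominates L, and the
-- same two obstructions rule out every other edge: a double star.

open import Defs hiding (_~_; ~-dec; ~-sym; ~-irr)
open import Data.Nat using (zero; suc; _≤_; s≤s; z≤n)
open import Data.Nat.Properties using (m<n⇒0<n)
open import Data.Fin using (Fin; zero; suc; _≟_)
open import Data.Fin.Patterns using (0F; 1F; 2F; 3F; 4F; 5F)
open import Data.Fin.Properties using (any?; all?; ¬∀⟶∃¬; suc-injective; toℕ<n)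
open import Data.Vec using (Vec; []; _∷_; lookup; head)
import Data.Vec.Functional as Vector
open import Data.Vec.Relation.Unary.All as All using (All; []; _∷_)
open import Data.Vec.Relation.Unary.AllPairs using ([]; _∷_; allPairs?)
open import Data.Vec.Relation.Unary.Linked as Linked using (Linked; []; [-]; _∷_; linked?)
open import Data.Vec.Relation.Unary.Unique.Propositional using (Unique)
open import Data.Vec.Relation.Unary.Unique.Propositional.Properties using (lookup-injective)
open import Data.Vec.Relation.Unary.Any using (here; there; index)
open import Data.Vec.Relation.Unary.Any.Properties using (lookup-index)
open import Data.Vec.Membership.Propositional using (_∈_; _∉_)
open import Data.Vec.Membership.Propositional.Properties using (∈-lookup)
open import Data.Unit using (⊤; tt)
open import Data.Empty using (⊥; ⊥-elim)
open import Data.Sum as Sum using (_⊎_; inj₁; inj₂)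
open import Data.Product using (Σ; _×_; ∃; ∃₂; ∃-syntax; _,_; proj₁; proj₂; map; map₂)
open import Function using (_∘_; id; _⇔_; mk⇔; Equivalence)
open import Function.Definitions using (Injective)
open import Relation.Unary using (Decidable)
open import Relation.Binary.Definitions using (Symmetric)
open import Relation.Nullary using (¬_; Dec; yes; no)
open import Relation.Nullary.Decidable using (_×-dec_; _⊎-dec_; _→-dec_; ¬?; decidable-stable)
open import Relation.Binary.PropositionalEquality using (_≡_; _≢_; refl; sym; cong; ≢-sym)

Enumerates : ∀ {n} {V : Set} → (Fin n → Set) → (V → Fin n) → Set
Enumerates P φ = Injective _≡_ _≡_ φ × (∀ x → P (φ x)) × (∀ v → P v → ∃ λ x → φ x ≡ v)

enumerates-suc : ∀ {n r} {P : Fin (suc n) → Set} {e : Fin r → Fin n} →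
  ¬ P zero → Enumerates (P ∘ suc) e → Enumerates P (suc ∘ e)
enumerates-suc {P = P} {e} ¬p₀ (inj , inP , cov) = inj ∘ suc-injective , inP , cover
  where
  cover : ∀ v → P v → ∃ λ i → suc (e i) ≡ v
  cover zero p₀ = ⊥-elim (¬p₀ p₀)
  cover (suc v) pv = map₂ (cong suc) (cov v pv)

enumerates-cons : ∀ {n r} {P : Fin n → Set} {v} {e : Fin r → Fin n} →
  P v → Enumerates (λ w → P w × w ≢ v) e → Enumerates P (v Vector.∷ e)
enumerates-cons {P = P} {v} {e} pv (inj , inP , cov) = inj′ , inP′ , cover
  where
  inj′ : Injective _≡_ _≡_ (v Vector.∷ e)
  inj′ {zero} {zero} _ = refl
  inj′ {zero} {suc j} eq = ⊥-elim (proj₂ (inP j) (sym eq))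
  inj′ {suc i} {zero} eq = ⊥-elim (proj₂ (inP i) eq)
  inj′ {suc i} {suc j} eq = cong suc (inj eq)
  inP′ : ∀ i → P ((v Vector.∷ e) i)
  inP′ zero = pv
  inP′ (suc i) = proj₁ (inP i)
  cover : ∀ w → P w → ∃ λ i → (v Vector.∷ e) i ≡ w
  cover w pw with w ≟ v
  ... | yes refl = zero , refl
  ... | no w≢v = map suc id (cov w (pw , w≢v))

enumerate : ∀ {n} {P : Fin n → Set} → Decidable P → ∃ λ r → Σ (Fin r → Fin n) (Enumerates P)
enumerate {zero} _ = zero , (λ ()) , (λ { {()} }) , (λ ()) , (λ ())
enumerate {suc n} P? with P? zero
... | no ¬p₀ = let r , e , enum = enumerate (P? ∘ suc) in r , suc ∘ e , enumerates-suc ¬p₀ enum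
... | yes p₀ =
  let r , e , enum = enumerate (λ v → P? (suc v) ×-dec ¬? (suc v ≟ zero))
  in suc r , zero Vector.∷ (suc ∘ e) , enumerates-cons p₀ (enumerates-suc (λ (_ , 0≢0) → 0≢0 refl) enum)

all-or-counterexample : ∀ {n} {P Q : Fin n → Set} → Decidable P → Decidable Q →
  (∀ v → P v → Q v) ⊎ ∃ λ v → P v × ¬ Q v
all-or-counterexample P? Q? with all? (λ v → P? v →-dec Q? v)
... | yes P⊆Q = inj₁ P⊆Q
... | no P⊈Q with ¬∀⟶∃¬ _ _ (λ v → P? v →-dec Q? v) P⊈Q
...   | v , ¬P⇒Q =
  inj₂ (v , decidable-stable (P? v) (λ ¬p → ¬P⇒Q (⊥-elim ∘ ¬p)) , λ q → ¬P⇒Q (λ _ → q))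

holds : ∀ {A B : Set} → A → B → A ⇔ B
holds a b = mk⇔ (λ _ → b) (λ _ → a)

absent : ∀ {A B : Set} → ¬ A → ¬ B → A ⇔ B
absent ¬a ¬b = mk⇔ (⊥-elim ∘ ¬a) (⊥-elim ∘ ¬b)

module _ {R H : Fin 4 → Fin 4 → Set} (R-sym : Symmetric R) (H-sym : Symmetric H)
         (R-irr : ∀ i → ¬ R i i) (H-irr : ∀ i → ¬ H i i) where

  agreement-on-Fin4 : R 0F 1F ⇔ H 0F 1F → R 0F 2F ⇔ H 0F 2F → R 0F 3F ⇔ H 0F 3F →
    R 1F 2F ⇔ H 1F 2F → R 1F 3F ⇔ H 1F 3F → R 2F 3F ⇔ H 2F 3F → ∀ i j → R i j ⇔ H i j
  agreement-on-Fin4 r01 r02 r03 r12 r13 r23 = agree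
    where
    flip : ∀ {i j} → R i j ⇔ H i j → R j i ⇔ H j i
    flip rij = mk⇔ (H-sym ∘ Equivalence.to rij ∘ R-sym) (R-sym ∘ Equivalence.from rij ∘ H-sym)
    agree : ∀ i j → R i j ⇔ H i j
    agree 0F 0F = absent (R-irr 0F) (H-irr 0F)
    agree 1F 1F = absent (R-irr 1F) (H-irr 1F)
    agree 2F 2F = absent (R-irr 2F) (H-irr 2F)
    agree 3F 3F = absent (R-irr 3F) (H-irr 3F)
    agree 0F 1F = r01
    agree 0F 2F = r02
    agree 0F 3F = r03
    agree 1F 2F = r12
    agree 1F 3F = r13
    agree 2F 3F = r23
    agree 1F 0F = flip r01
    agree 2F 0F = flip r02
    agree 3F 0F = flip r03
    agree 2F 1F = flip r12
    agree 3F 1F = flip r13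
    agree 3F 2F = flip r23

∉⇒All≢ : ∀ {n k} {x : Fin n} {xs : Vec (Fin n) k} → x ∉ xs → All (x ≢_) xs
∉⇒All≢ {xs = []} _ = []
∉⇒All≢ {xs = y ∷ ys} x∉ = (x∉ ∘ here) ∷ ∉⇒All≢ (x∉ ∘ there)

rotate-All : ∀ {A : Set} {P : A → Set} {a b c d} →
  All P (a ∷ b ∷ c ∷ d ∷ []) → All P (b ∷ c ∷ d ∷ a ∷ [])
rotate-All (pa ∷ pb ∷ pc ∷ pd ∷ []) = pb ∷ pc ∷ pd ∷ pa ∷ []

C4Edge-irr : ∀ i → ¬ C4Edge i i
C4Edge-irr 0F ()
C4Edge-irr 1F ()
C4Edge-irr 2F ()
C4Edge-irr 3F ()

C4Adj-irr : ∀ i → ¬ C4Adj i i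
C4Adj-irr i (inj₁ e) = C4Edge-irr i e
C4Adj-irr i (inj₂ e) = C4Edge-irr i e

C4Adj-sym : Symmetric C4Adj
C4Adj-sym = Sum.swap

C4Adj-no-diagonal₀₂ : ¬ C4Adj 0F 2F
C4Adj-no-diagonal₀₂ (inj₁ ())
C4Adj-no-diagonal₀₂ (inj₂ ())

C4Adj-no-diagonal₁₃ : ¬ C4Adj 1F 3F
C4Adj-no-diagonal₁₃ (inj₁ ())
C4Adj-no-diagonal₁₃ (inj₂ ())

C3⁺Adj-irr : ∀ i → ¬ C3⁺Adj i i
C3⁺Adj-irr i (inj₁ e) = C4Adj-irr i e
C3⁺Adj-irr _ (inj₂ (inj₁ (refl , ())))
C3⁺Adj-irr _ (inj₂ (inj₂ (refl , ())))

C3⁺Adj-sym : Symmetric C3⁺Adj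
C3⁺Adj-sym (inj₁ e) = inj₁ (C4Adj-sym e)
C3⁺Adj-sym (inj₂ (inj₁ (i≡1 , j≡3))) = inj₂ (inj₂ (j≡3 , i≡1))
C3⁺Adj-sym (inj₂ (inj₂ (i≡3 , j≡1))) = inj₂ (inj₁ (j≡1 , i≡3))

C3⁺Adj-no-diagonal₀₂ : ¬ C3⁺Adj 0F 2F
C3⁺Adj-no-diagonal₀₂ (inj₁ e) = C4Adj-no-diagonal₀₂ e
C3⁺Adj-no-diagonal₀₂ (inj₂ (inj₁ (() , _)))
C3⁺Adj-no-diagonal₀₂ (inj₂ (inj₂ (() , _)))

K4Adj-irr : ∀ i → ¬ K4Adj i i
K4Adj-irr i i≢i = i≢i refl

module GraphProperties {n} (G : Graph n) where
  open Graph G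

  ~⇒≢ : ∀ {x y} → x ~ y → x ≢ y
  ~⇒≢ x~x refl = ~-irr x~x

  separated : ∀ {h x y} → h ~ x → ¬ h ~ y → x ≢ y
  separated h~x h≁x refl = h≁x h~x

  PathIn : VSet n → ∀ {k} → Vec (Fin n) k → Set
  PathIn S xs = All S xs × Unique xs × Linked _~_ xs

  pathIn? : ∀ {S} → Decidable S → ∀ {k} → Decidable (PathIn S {k})
  pathIn? S? xs = All.all? S? xs ×-dec allPairs? (λ x y → ¬? (x ≟ y)) xs ×-dec linked? ~-dec xs

  extend : ∀ {S k x} {xs : Vec (Fin n) (suc k)} → PathIn S xs →
    S x → All (x ≢_) xs → x ~ head xs → PathIn S (x ∷ xs)
  extend (inS , distinct , linked) sx fresh x~xs = sx ∷ inS , fresh ∷ distinct , x~xs ∷ linked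

  path-tail : ∀ {S k x} {xs : Vec (Fin n) (suc k)} → PathIn S (x ∷ xs) → PathIn S xs
  path-tail (_ ∷ inS , _ ∷ distinct , linked) = inS , distinct , Linked.tail linked

  P₅-free : VSet n → Set
  P₅-free S = (xs : Vec (Fin n) 5) → ¬ PathIn S xs

  P₅-free-⊆ : ∀ {S T} → (∀ v → S v → T v) → P₅-free T → P₅-free S
  P₅-free-⊆ S⊆T free xs (inS , distinct , linked) = free xs (All.map (S⊆T _) inS , distinct , linked)

  neighbourhood-P₅-free : C5⁺Free G → ∀ u → P₅-free (Nbhd G u)
  neighbourhood-P₅-free free u (a ∷ b ∷ c ∷ d ∷ e ∷ [])
    ( (u~a ∷ u~b ∷ u~c ∷ u~d ∷ u~e ∷ [])
    , (a≢b ∷ a≢c ∷ a≢d ∷ a≢e ∷ []) ∷ (b≢c ∷ b≢d ∷ b≢e ∷ []) ∷ (c≢d ∷ c≢e ∷ []) ∷ (d≢e ∷ [])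
      ∷ [] ∷ []
    , a~b ∷ b~c ∷ c~d ∷ d~e ∷ [-]) =
    free (lookup vertices , lookup-injective distinct _ _ , edges)
    where
    vertices : Vec (Fin n) 6
    vertices = u ∷ b ∷ c ∷ d ∷ e ∷ a ∷ []
    distinct : Unique vertices
    distinct = (~⇒≢ u~b ∷ ~⇒≢ u~c ∷ ~⇒≢ u~d ∷ ~⇒≢ u~e ∷ ~⇒≢ u~a ∷ [])
             ∷ (b≢c ∷ b≢d ∷ b≢e ∷ ≢-sym a≢b ∷ [])
             ∷ (c≢d ∷ c≢e ∷ ≢-sym a≢c ∷ [])
             ∷ (d≢e ∷ ≢-sym a≢d ∷ [])
             ∷ (≢-sym a≢e ∷ []) ∷ [] ∷ []
    edges : ∀ i j → C5⁺Edge i j → lookup vertices i ~ lookup vertices j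
    edges 0F 1F _ = u~b
    edges 1F 2F _ = b~c
    edges 2F 3F _ = c~d
    edges 3F 4F _ = d~e
    edges 4F 0F _ = ~-sym u~e
    edges 5F 0F _ = ~-sym u~a
    edges 5F 1F _ = a~b
    edges 0F 0F ()
    edges 0F (suc (suc _)) ()
    edges 1F 0F ()
    edges 1F 1F ()
    edges 1F (suc (suc (suc _))) ()
    edges 2F 0F ()
    edges 2F 1F ()
    edges 2F 2F ()
    edges 2F (suc (suc (suc (suc _)))) ()
    edges 3F 0F ()
    edges 3F 1F ()
    edges 3F 2F ()
    edges 3F 3F ()
    edges 3F (suc (suc (suc (suc (suc _))))) ()
    edges 4F (suc _) ()
    edges 5F (suc (suc _)) ()

  walk-end : ∀ {S x y} → ReachIn G S x y → S y
  walk-end (here sy) = sy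
  walk-end (step _ _ sy) = sy

  walk-within : ∀ {S T x y} → (∀ x y → T x → S y → x ~ y → T y) →
    T x → ReachIn G S x y → ReachIn G T x y
  walk-within closed tx (here _) = here tx
  walk-within closed tx (step w y~z sz) with walk-within closed tx w
  ... | w′ = step w′ y~z (closed _ _ (walk-end w′) sz y~z)

  component-connected : ∀ {S L} → IsComponent G S L → ∀ {x y} → L x → L y → ReachIn G L x y
  component-connected (_ , _ , connected , closed) {x} {y} lx ly =
    walk-within closed lx (connected x y lx ly)

  crossing-edge : ∀ {S T : VSet n} {x y} → Decidable T → ReachIn G S x y → T x → ¬ T y →
    ∃₂ λ p q → S p × S q × T p × ¬ T q × p ~ q
  crossing-edge T? (here _) tx ¬ty = ⊥-elim (¬ty tx)
  crossing-edge T? (step {y} {z} w y~z sz) tx ¬tz with T? y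
  ... | yes ty = y , z , walk-end w , sz , ty , ¬tz , y~z
  ... | no ¬ty = crossing-edge T? w tx ¬ty

  inducedIso : ∀ {L V H} (φ : V → Fin n) → Enumerates L φ →
    (∀ x y → φ x ~ φ y ⇔ H x y) → InducedIso G L V H
  inducedIso φ (inj , inL , cover) agree =
    φ , inj , inL , cover , λ x y → Equivalence.to (agree x y) , Equivalence.from (agree x y)

  lookupIso : ∀ {k L H} (xs : Vec (Fin n) k) → Unique xs → All L xs → (∀ v → L v → v ∈ xs) →
    (∀ i j → lookup xs i ~ lookup xs j ⇔ H i j) → InducedIso G L (Fin k) H
  lookupIso xs distinct inL spans = inducedIso (lookup xs)
    ( lookup-injective distinct _ _
    , (λ i → All.lookup inL (∈-lookup i xs))
    , λ v lv → index (spans v lv) , sym (lookup-index (spans v lv)))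

Shapes : ∀ {n} → Graph n → VSet n → Set
Shapes G L =
    (∃ λ r → InducedIso G L (⊤ ⊎ Fin r) (StarAdj r))
  ⊎ (∃ λ a → ∃ λ b → 1 ≤ a × 1 ≤ b × InducedIso G L (DSV a b) (DSAdj a b))
  ⊎ (∃ λ r → 2 ≤ r × InducedIso G L (⊤ ⊎ Fin r) (S1Adj r))
  ⊎ InducedIso G L (Fin 4) C4Adj
  ⊎ InducedIso G L (Fin 4) C3⁺Adj
  ⊎ InducedIso G L (Fin 4) K4Adj

module Classification {n} (G : Graph n) {L : VSet n} (L? : Decidable L) {v₀ : Fin n} (lv₀ : L v₀)
    (connected : ∀ {x y} → L x → L y → ReachIn G L x y)
    (p₅-free : GraphProperties.P₅-free G L) where
  open Graph G
  open GraphProperties G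
  open import Data.Vec.Membership.DecPropositional (_≟_ {n}) using (_∈?_)

  crossing : ∀ {T : VSet n} {x y} → Decidable T → L x → L y → T x → ¬ T y →
    ∃₂ λ p q → L p × L q × T p × ¬ T q × p ~ q
  crossing T? lx ly = crossing-edge T? (connected lx ly)

  Path₄ : Fin n → Fin n → Fin n → Fin n → Set
  Path₄ a b c d = PathIn L (a ∷ b ∷ c ∷ d ∷ [])

  path₄ : ∀ {a b c d} → L a → L b → L c → L d → a ≢ c → a ≢ d → b ≢ d →
    a ~ b → b ~ c → c ~ d → Path₄ a b c d
  path₄ la lb lc ld a≢c a≢d b≢d a~b b~c c~d =
      la ∷ lb ∷ lc ∷ ld ∷ []
    , (~⇒≢ a~b ∷ a≢c ∷ a≢d ∷ []) ∷ (~⇒≢ b~c ∷ b≢d ∷ []) ∷ (~⇒≢ c~d ∷ []) ∷ [] ∷ []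
    , a~b ∷ b~c ∷ c~d ∷ [-]

  reverse₄ : ∀ {a b c d} → Path₄ a b c d → Path₄ d c b a
  reverse₄ ( la ∷ lb ∷ lc ∷ ld ∷ []
           , (_ ∷ a≢c ∷ a≢d ∷ []) ∷ (_ ∷ b≢d ∷ []) ∷ _ ∷ [] ∷ []
           , a~b ∷ b~c ∷ c~d ∷ [-]) =
    path₄ ld lc lb la (≢-sym b≢d) (≢-sym a≢d) (≢-sym a≢c) (~-sym c~d) (~-sym b~c) (~-sym a~b)

  cannot-extend : ∀ {a b c d x} → Path₄ a b c d → L x → All (x ≢_) (a ∷ b ∷ c ∷ d ∷ []) →
    ¬ a ~ x
  cannot-extend P lx fresh a~x = p₅-free _ (extend P lx fresh (~-sym a~x))

  Cycle₄ : Fin n → Fin n → Fin n → Fin n → Set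
  Cycle₄ a b c d = Path₄ a b c d × d ~ a

  Has-C₄ : Set
  Has-C₄ = ∃[ a ] ∃[ b ] ∃[ c ] ∃[ d ] Cycle₄ a b c d

  has-C₄? : Dec Has-C₄
  has-C₄? = any? λ a → any? λ b → any? λ c → any? λ d → pathIn? L? _ ×-dec ~-dec d a

  cycle₄ : ∀ {a b c d} → L a → L b → L c → L d → a ≢ c → b ≢ d →
    a ~ b → b ~ c → c ~ d → d ~ a → Cycle₄ a b c d
  cycle₄ la lb lc ld a≢c b≢d a~b b~c c~d d~a =
    path₄ la lb lc ld a≢c (≢-sym (~⇒≢ d~a)) b≢d a~b b~c c~d , d~a

  rotate : ∀ {a b c d} → Cycle₄ a b c d → Cycle₄ b c d a
  rotate (( la ∷ lb ∷ lc ∷ ld ∷ []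
          , (_ ∷ a≢c ∷ _ ∷ []) ∷ (_ ∷ b≢d ∷ []) ∷ _ ∷ [] ∷ []
          , a~b ∷ b~c ∷ c~d ∷ [-]) , d~a) =
    cycle₄ lb lc ld la b≢d (≢-sym a≢c) b~c c~d d~a a~b

  cycle-spans : ∀ {a b c d} → Cycle₄ a b c d → ∀ v → L v → v ∈ (a ∷ b ∷ c ∷ d ∷ [])
  cycle-spans {a} {b} {c} {d} C@((la ∷ _ , _) , _) v lv with v ∈? (a ∷ b ∷ c ∷ d ∷ [])
  ... | yes v∈ = v∈
  ... | no v∉ with crossing (_∈? (a ∷ b ∷ c ∷ d ∷ [])) la lv (here refl) v∉
  ...   | p , q , _ , lq , p∈ , q∉ , p~q = ⊥-elim (pendant p∈)
    where
    fresh : All (q ≢_) (a ∷ b ∷ c ∷ d ∷ [])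
    fresh = ∉⇒All≢ q∉
    pendant : p ∈ (a ∷ b ∷ c ∷ d ∷ []) → ⊥
    pendant (here refl) = cannot-extend (proj₁ C) lq fresh p~q
    pendant (there (here refl)) =
      cannot-extend (proj₁ (rotate C)) lq (rotate-All fresh) p~q
    pendant (there (there (here refl))) =
      cannot-extend (proj₁ (rotate (rotate C))) lq (rotate-All (rotate-All fresh)) p~q
    pendant (there (there (there (here refl)))) =
      cannot-extend (proj₁ (rotate (rotate (rotate C)))) lq
        (rotate-All (rotate-All (rotate-All fresh))) p~q

  cycleIso : ∀ {a b c d H} → Cycle₄ a b c d → Symmetric H → (∀ i → ¬ H i i) →
    H 0F 1F → H 1F 2F → H 2F 3F → H 3F 0F → a ~ c ⇔ H 0F 2F → b ~ d ⇔ H 1F 3F →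
    InducedIso G L (Fin 4) H
  cycleIso C@((inL , distinct , a~b ∷ b~c ∷ c~d ∷ [-]) , d~a)
           H-sym H-irr h₀₁ h₁₂ h₂₃ h₃₀ a~c⇔ b~d⇔ =
    lookupIso _ distinct inL (cycle-spans C)
      (agreement-on-Fin4 ~-sym H-sym (λ _ → ~-irr) H-irr
        (holds a~b h₀₁) a~c⇔ (holds (~-sym d~a) (H-sym h₃₀)) (holds b~c h₁₂) b~d⇔ (holds c~d h₂₃))

  C4-iso : ∀ {a b c d} → Cycle₄ a b c d → ¬ a ~ c → ¬ b ~ d → InducedIso G L (Fin 4) C4Adj
  C4-iso C a≁c b≁d = cycleIso C C4Adj-sym C4Adj-irr (inj₁ tt) (inj₁ tt) (inj₁ tt) (inj₁ tt)
    (absent a≁c C4Adj-no-diagonal₀₂) (absent b≁d C4Adj-no-diagonal₁₃)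

  C3⁺-iso : ∀ {a b c d} → Cycle₄ a b c d → ¬ a ~ c → b ~ d → InducedIso G L (Fin 4) C3⁺Adj
  C3⁺-iso C a≁c b~d = cycleIso C C3⁺Adj-sym C3⁺Adj-irr
    (inj₁ (inj₁ tt)) (inj₁ (inj₁ tt)) (inj₁ (inj₁ tt)) (inj₁ (inj₁ tt))
    (absent a≁c C3⁺Adj-no-diagonal₀₂) (holds b~d (inj₂ (inj₁ (refl , refl))))

  K4-iso : ∀ {a b c d} → Cycle₄ a b c d → a ~ c → b ~ d → InducedIso G L (Fin 4) K4Adj
  K4-iso C a~c b~d = cycleIso C ≢-sym K4Adj-irr (λ ()) (λ ()) (λ ()) (λ ())
    (holds a~c (λ ())) (holds b~d (λ ()))

  cycle-case : ∀ {a b c d} → Cycle₄ a b c d → Shapes G L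
  cycle-case {a} {b} {c} {d} C with ~-dec a c | ~-dec b d
  ... | no a≁c  | no b≁d  = inj₂ (inj₂ (inj₂ (inj₁ (C4-iso C a≁c b≁d))))
  ... | no a≁c  | yes b~d = inj₂ (inj₂ (inj₂ (inj₂ (inj₁ (C3⁺-iso C a≁c b~d)))))
  ... | yes a~c | no b≁d  = inj₂ (inj₂ (inj₂ (inj₂ (inj₁ (C3⁺-iso (rotate C) b≁d (~-sym a~c))))))
  ... | yes a~c | yes b~d = inj₂ (inj₂ (inj₂ (inj₂ (inj₂ (K4-iso C a~c b~d)))))

  Leaf : Fin n → Fin n → Set
  Leaf c v = L v × v ≢ c

  leaf? : ∀ c → Decidable (Leaf c)
  leaf? c v = L? v ×-dec ¬? (v ≟ c)

  Dominating : Fin n → Set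
  Dominating c = ∀ v → Leaf c v → c ~ v

  dominating? : Decidable Dominating
  dominating? c = all? λ v → leaf? c v →-dec ~-dec c v

  non-neighbour : ∀ {c} → ¬ Dominating c → ∃ λ v → Leaf c v × ¬ c ~ v
  non-neighbour {c} ¬dom with all-or-counterexample (leaf? c) (~-dec c)
  ... | inj₁ dom = ⊥-elim (¬dom dom)
  ... | inj₂ v-far = v-far

  coneIso : ∀ {c r} {e : Fin r → Fin n} {H : ⊤ ⊎ Fin r → ⊤ ⊎ Fin r → Set} →
    L c → Dominating c → Enumerates (Leaf c) e →
    ¬ H (inj₁ tt) (inj₁ tt) → (∀ i → H (inj₁ tt) (inj₂ i)) → (∀ i → H (inj₂ i) (inj₁ tt)) →
    (∀ i j → e i ~ e j ⇔ H (inj₂ i) (inj₂ j)) → InducedIso G L (⊤ ⊎ Fin r) H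
  coneIso {c} {r} {e} {H} lc dom (inj , leaf , cover) no-loop hub→leaf leaf→hub leaves =
    inducedIso φ (φ-inj , inL , φ-cover) agree
    where
    φ : ⊤ ⊎ Fin r → Fin n
    φ (inj₁ _) = c
    φ (inj₂ i) = e i
    φ-inj : Injective _≡_ _≡_ φ
    φ-inj {inj₁ tt} {inj₁ tt} _ = refl
    φ-inj {inj₁ tt} {inj₂ j} c≡eⱼ = ⊥-elim (proj₂ (leaf j) (sym c≡eⱼ))
    φ-inj {inj₂ i} {inj₁ tt} eᵢ≡c = ⊥-elim (proj₂ (leaf i) eᵢ≡c)
    φ-inj {inj₂ i} {inj₂ j} eᵢ≡eⱼ = cong inj₂ (inj eᵢ≡eⱼ)
    inL : ∀ x → L (φ x)
    inL (inj₁ _) = lc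
    inL (inj₂ i) = proj₁ (leaf i)
    φ-cover : ∀ v → L v → ∃ λ x → φ x ≡ v
    φ-cover v lv with v ≟ c
    ... | yes refl = inj₁ tt , refl
    ... | no v≢c with cover v (lv , v≢c)
    ...   | i , eᵢ≡v = inj₂ i , eᵢ≡v
    agree : ∀ x y → φ x ~ φ y ⇔ H x y
    agree (inj₁ tt) (inj₁ tt) = absent ~-irr no-loop
    agree (inj₁ tt) (inj₂ j) = holds (dom _ (leaf j)) (hub→leaf j)
    agree (inj₂ i) (inj₁ tt) = holds (~-sym (dom _ (leaf i))) (leaf→hub i)
    agree (inj₂ i) (inj₂ j) = leaves i j

  LeafEdge : Fin n → Set
  LeafEdge c = ∃₂ λ p q → Leaf c p × Leaf c q × p ~ q

  leaf-edge? : ∀ c → Dec (LeafEdge c)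
  leaf-edge? c = any? λ p → any? λ q → leaf? c p ×-dec leaf? c q ×-dec ~-dec p q

  star-case : ∀ {c} → L c → Dominating c → ¬ LeafEdge c →
    ∃ λ r → InducedIso G L (⊤ ⊎ Fin r) (StarAdj r)
  star-case {c} lc dom no-edge with enumerate (leaf? c)
  ... | r , e , leaves@(_ , leaf , _) =
    r , coneIso lc dom leaves (λ ()) (λ _ → tt) (λ _ → tt)
          (λ i j → absent (λ eᵢ~eⱼ → no-edge (e i , e j , leaf i , leaf j , eᵢ~eⱼ)) λ ())

  S1-case : ∀ {c p q} → ¬ Has-C₄ → L c → Dominating c → Leaf c p → Leaf c q → p ~ q →
    ∃ λ r → 2 ≤ r × InducedIso G L (⊤ ⊎ Fin r) (S1Adj r)
  S1-case {c} {p} {q} no-C₄ lc dom p-leaf@(lp , p≢c) q-leaf@(lq , q≢c) p~q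
    with enumerate (λ v → (leaf? c v ×-dec ¬? (v ≟ p)) ×-dec ¬? (v ≟ q))
  ... | m , e , others@(_ , other , _) =
    suc (suc m) , s≤s (s≤s z≤n) ,
    coneIso lc dom (enumerates-cons p-leaf (enumerates-cons (q-leaf , ≢-sym (~⇒≢ p~q)) others))
      (λ ()) (λ _ → tt) (λ _ → tt) agree
    where
    c~ : ∀ {v} → Leaf c v → c ~ v
    c~ = dom _
    p≁e : ∀ k → ¬ p ~ e k
    p≁e k p~eₖ with other k
    ... | ((lₖ , eₖ≢c) , _) , eₖ≢q =
      no-C₄ (_ , _ , _ , _ ,
        cycle₄ lₖ lp lq lc eₖ≢q p≢c (~-sym p~eₖ) p~q (~-sym (c~ q-leaf)) (c~ (lₖ , eₖ≢c)))
    q≁e : ∀ k → ¬ q ~ e k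
    q≁e k q~eₖ with other k
    ... | ((lₖ , eₖ≢c) , eₖ≢p) , _ =
      no-C₄ (_ , _ , _ , _ ,
        cycle₄ lₖ lq lp lc eₖ≢p q≢c (~-sym q~eₖ) (~-sym p~q) (~-sym (c~ p-leaf)) (c~ (lₖ , eₖ≢c)))
    e≁e : ∀ k l → ¬ e k ~ e l
    e≁e k l eₖ~eₗ with other k | other l
    ... | ((lₖ , eₖ≢c) , eₖ≢p) , eₖ≢q | ((lₗ , eₗ≢c) , eₗ≢p) , eₗ≢q =
      cannot-extend
        (path₄ lₗ lc lp lq eₗ≢p eₗ≢q (≢-sym q≢c) (~-sym (c~ (lₗ , eₗ≢c))) (c~ p-leaf) p~q) lₖ
        (~⇒≢ eₖ~eₗ ∷ eₖ≢c ∷ eₖ≢p ∷ eₖ≢q ∷ []) (~-sym eₖ~eₗ)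
    agree : ∀ i j → (p Vector.∷ (q Vector.∷ e)) i ~ (p Vector.∷ (q Vector.∷ e)) j
                    ⇔ S1Adj (suc (suc m)) (inj₂ i) (inj₂ j)
    agree 0F 0F = absent ~-irr λ { (inj₁ (_ , ())) ; (inj₂ (() , _)) }
    agree 1F 1F = absent ~-irr λ { (inj₁ (() , _)) ; (inj₂ (_ , ())) }
    agree 0F 1F = holds p~q (inj₁ (refl , refl))
    agree 1F 0F = holds (~-sym p~q) (inj₂ (refl , refl))
    agree 0F (suc (suc k)) = absent (p≁e k) λ { (inj₁ (_ , ())) ; (inj₂ (() , _)) }
    agree 1F (suc (suc k)) = absent (q≁e k) λ { (inj₁ (() , _)) ; (inj₂ (_ , ())) }
    agree (suc (suc k)) 0F = absent (p≁e k ∘ ~-sym) λ { (inj₁ (() , _)) ; (inj₂ (() , _)) }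
    agree (suc (suc k)) 1F = absent (q≁e k ∘ ~-sym) λ { (inj₁ (() , _)) ; (inj₂ (() , _)) }
    agree (suc (suc k)) (suc (suc l)) = absent (e≁e k l) λ { (inj₁ (() , _)) ; (inj₂ (() , _)) }

  DominatedBy : Fin n → Fin n → Fin n → Set
  DominatedBy x y v = v ≡ x ⊎ v ≡ y ⊎ x ~ v ⊎ y ~ v

  dominatedBy? : ∀ x y → Decidable (DominatedBy x y)
  dominatedBy? x y v = v ≟ x ⊎-dec v ≟ y ⊎-dec ~-dec x v ⊎-dec ~-dec y v

  DominatedBy-comm : ∀ {x y v} → DominatedBy x y v → DominatedBy y x v
  DominatedBy-comm (inj₁ v≡x) = inj₂ (inj₁ v≡x)
  DominatedBy-comm (inj₂ (inj₁ v≡y)) = inj₁ v≡y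
  DominatedBy-comm (inj₂ (inj₂ (inj₁ x~v))) = inj₂ (inj₂ (inj₂ x~v))
  DominatedBy-comm (inj₂ (inj₂ (inj₂ y~v))) = inj₂ (inj₂ (inj₁ y~v))

  DominatingEdge : Fin n → Fin n → Set
  DominatingEdge x y = L x × L y × x ~ y × (∀ v → L v → DominatedBy x y v)

  far-from-path : ∀ {a b c d q} → Path₄ a b c d → ¬ DominatedBy b c q →
    All (q ≢_) (a ∷ b ∷ c ∷ d ∷ [])
  far-from-path {a} {b} {c} {d} {q} (_ , _ , a~b ∷ _ ∷ c~d ∷ [-]) q-far =
    q≢a ∷ q-far ∘ inj₁ ∷ q-far ∘ inj₂ ∘ inj₁ ∷ q≢d ∷ []
    where
    q≢a : q ≢ a
    q≢a refl = q-far (inj₂ (inj₂ (inj₁ (~-sym a~b))))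
    q≢d : q ≢ d
    q≢d refl = q-far (inj₂ (inj₂ (inj₂ c~d)))

  undominated-not-second-neighbour : ∀ {a b c d p q} → Path₄ a b c d → L p → L q → p ~ q →
    ¬ DominatedBy b c q → ¬ b ~ p
  undominated-not-second-neighbour {a} {b} {c} {d} {p} P lp lq p~q q-far b~p with p ≟ a | p ≟ d | p ≟ c
  ... | yes refl | _ | _ = cannot-extend P lq (far-from-path P q-far) p~q
  ... | no _ | yes refl | _ =
    cannot-extend (reverse₄ P) lq (far-from-path (reverse₄ P) (q-far ∘ DominatedBy-comm)) p~q
  ... | no _ | no _ | yes refl = q-far (inj₂ (inj₂ (inj₂ p~q)))
  ... | no _ | no p≢d | no p≢c =
    cannot-extend (extend (path-tail P) lp (≢-sym (~⇒≢ b~p) ∷ p≢c ∷ p≢d ∷ []) (~-sym b~p)) lq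
      (≢-sym (~⇒≢ p~q) ∷ All.tail (far-from-path P q-far)) p~q

  middle-edge-dominates : ∀ {a b c d} → Path₄ a b c d → ∀ v → L v → DominatedBy b c v
  middle-edge-dominates {b = b} {c} P@(_ ∷ lb ∷ _ , _) v lv with dominatedBy? b c v
  ... | yes dominated = dominated
  ... | no v-far with crossing (dominatedBy? b c) lb lv (inj₁ refl) v-far
  ...   | p , q , lp , lq , p-near , q-far , p~q = ⊥-elim (escape p-near)
    where
    escape : DominatedBy b c p → ⊥
    escape (inj₁ refl) = q-far (inj₂ (inj₂ (inj₁ p~q)))
    escape (inj₂ (inj₁ refl)) = q-far (inj₂ (inj₂ (inj₂ p~q)))
    escape (inj₂ (inj₂ (inj₁ b~p))) = undominated-not-second-neighbour P lp lq p~q q-far b~p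
    escape (inj₂ (inj₂ (inj₂ c~p))) =
      undominated-not-second-neighbour (reverse₄ P) lp lq p~q (q-far ∘ DominatedBy-comm) c~p

  edge-to-dominating-edge : ∀ {x y} → L x → L y → x ~ y → ∃₂ DominatingEdge
  edge-to-dominating-edge {x} {y} lx ly x~y with all-or-counterexample L? (dominatedBy? x y)
  ... | inj₁ dominated = x , y , lx , ly , x~y , dominated
  ... | inj₂ (v , lv , v-far) with crossing (dominatedBy? x y) lx lv (inj₁ refl) v-far
  ...   | p , q , lp , lq , p-near , q-far , p~q = attach p-near
    where
    q≢x : q ≢ x
    q≢x = q-far ∘ inj₁
    q≢y : q ≢ y
    q≢y = q-far ∘ inj₂ ∘ inj₁
    p≢x : p ≢ x
    p≢x refl = q-far (inj₂ (inj₂ (inj₁ p~q)))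
    p≢y : p ≢ y
    p≢y refl = q-far (inj₂ (inj₂ (inj₂ p~q)))
    attach : DominatedBy x y p → ∃₂ DominatingEdge
    attach (inj₁ p≡x) = ⊥-elim (p≢x p≡x)
    attach (inj₂ (inj₁ p≡y)) = ⊥-elim (p≢y p≡y)
    attach (inj₂ (inj₂ (inj₁ x~p))) = p , x , lp , lx , ~-sym x~p ,
      middle-edge-dominates (path₄ lq lp lx ly q≢x q≢y p≢y (~-sym p~q) (~-sym x~p) x~y)
    attach (inj₂ (inj₂ (inj₂ y~p))) = p , y , lp , ly , ~-sym y~p ,
      middle-edge-dominates (path₄ lq lp ly lx q≢y q≢x p≢x (~-sym p~q) (~-sym y~p) (~-sym x~y))

  dominating-edge : (∀ c → L c → ¬ Dominating c) → ∃₂ DominatingEdge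
  dominating-edge none with non-neighbour (none v₀ lv₀)
  ... | z , (lz , z≢v₀) , _ with crossing (_≟ v₀) lv₀ lz refl z≢v₀
  ...   | _ , _ , lp , lq , refl , _ , p~q = edge-to-dominating-edge lp lq p~q

  module DoubleStar {h₁ h₂} (lh₁ : L h₁) (lh₂ : L h₂) (h₁~h₂ : h₁ ~ h₂)
      (dominated : ∀ v → L v → DominatedBy h₁ h₂ v)
      (no-C₄ : ¬ Has-C₄) (none : ∀ c → L c → ¬ Dominating c) where

    Outer : Fin n → Set
    Outer v = L v × v ≢ h₁ × v ≢ h₂

    ≢h₁ : ∀ {v} → Outer v → v ≢ h₁
    ≢h₁ (_ , v≢h₁ , _) = v≢h₁

    ≢h₂ : ∀ {v} → Outer v → v ≢ h₂
    ≢h₂ (_ , _ , v≢h₂) = v≢h₂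

    Leaf₁ Leaf₂ : Fin n → Set
    Leaf₁ v = Outer v × h₁ ~ v
    Leaf₂ v = Outer v × ¬ h₁ ~ v

    leaf₁? : Decidable Leaf₁
    leaf₁? v = (L? v ×-dec ¬? (v ≟ h₁) ×-dec ¬? (v ≟ h₂)) ×-dec ~-dec h₁ v

    leaf₂? : Decidable Leaf₂
    leaf₂? v = (L? v ×-dec ¬? (v ≟ h₁) ×-dec ¬? (v ≟ h₂)) ×-dec ¬? (~-dec h₁ v)

    outer-attached : ∀ {v} → Outer v → h₁ ~ v ⊎ h₂ ~ v
    outer-attached {v} (lv , v≢h₁ , v≢h₂) with dominated v lv
    ... | inj₁ v≡h₁ = ⊥-elim (v≢h₁ v≡h₁)
    ... | inj₂ (inj₁ v≡h₂) = ⊥-elim (v≢h₂ v≡h₂)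
    ... | inj₂ (inj₂ attached) = attached

    leaf₂-attached : ∀ {v} → Leaf₂ v → h₂ ~ v
    leaf₂-attached (outer , h₁≁v) = Sum.[ ⊥-elim ∘ h₁≁v , id ] (outer-attached outer)

    leaf₁-witness : ∃ λ z → Leaf₁ z × ¬ h₂ ~ z
    leaf₁-witness with non-neighbour (none h₂ lh₂)
    ... | z , (lz , z≢h₂) , h₂≁z =
      z , (outer , Sum.[ id , ⊥-elim ∘ h₂≁z ] (outer-attached outer)) , h₂≁z
      where
      outer : Outer z
      outer = lz , (λ { refl → h₂≁z (~-sym h₁~h₂) }) , z≢h₂

    leaf₂-witness : ∃ Leaf₂
    leaf₂-witness with non-neighbour (none h₁ lh₁)
    ... | w , (lw , w≢h₁) , h₁≁w = w , (lw , w≢h₁ , λ { refl → h₁≁w h₁~h₂ }) , h₁≁w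

    leaf₁-detached : ∀ {x} → Leaf₁ x → ¬ h₂ ~ x
    leaf₁-detached ((lx , x≢h₁ , x≢h₂) , h₁~x) h₂~x
      with leaf₁-witness | leaf₂-witness
    ... | z , ((lz , z≢h₁ , z≢h₂) , h₁~z) , h₂≁z | w , w-leaf@((lw , w≢h₁ , w≢h₂) , h₁≁w) =
      cannot-extend
        (path₄ lh₂ lx lh₁ lz (~⇒≢ h₁~h₂ ∘ sym) (≢-sym z≢h₂) (separated h₂~x h₂≁z)
          h₂~x (~-sym h₁~x) h₁~z)
        lw (w≢h₂ ∷ separated h₁~x h₁≁w ∘ sym ∷ w≢h₁ ∷ separated h₁~z h₁≁w ∘ sym ∷ [])
        (leaf₂-attached w-leaf)

    leaves₁-independent : ∀ {x y} → Leaf₁ x → Leaf₁ y → ¬ x ~ y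
    leaves₁-independent ((lx , x≢h₁ , x≢h₂) , h₁~x) ((ly , y≢h₁ , y≢h₂) , h₁~y) x~y
      with leaf₂-witness
    ... | w , w-leaf@((lw , w≢h₁ , w≢h₂) , h₁≁w) =
      cannot-extend
        (path₄ lh₂ lh₁ lx ly (≢-sym x≢h₂) (≢-sym y≢h₂) (≢-sym y≢h₁) (~-sym h₁~h₂) h₁~x x~y)
        lw (w≢h₂ ∷ w≢h₁ ∷ separated h₁~x h₁≁w ∘ sym ∷ separated h₁~y h₁≁w ∘ sym ∷ [])
        (leaf₂-attached w-leaf)

    leaves₂-independent : ∀ {x y} → Leaf₂ x → Leaf₂ y → ¬ x ~ y
    leaves₂-independent x-leaf@((lx , x≢h₁ , x≢h₂) , h₁≁x) ((ly , y≢h₁ , y≢h₂) , h₁≁y) x~y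
      with leaf₁-witness
    ... | z , ((lz , z≢h₁ , z≢h₂) , h₁~z) , _ =
      cannot-extend
        (path₄ lh₁ lh₂ lx ly (≢-sym x≢h₁) (≢-sym y≢h₁) (≢-sym y≢h₂)
          h₁~h₂ (leaf₂-attached x-leaf) x~y)
        lz (z≢h₁ ∷ z≢h₂ ∷ separated h₁~z h₁≁x ∷ separated h₁~z h₁≁y ∷ [])
        h₁~z

    leaves-independent : ∀ {x y} → Leaf₁ x → Leaf₂ y → ¬ x ~ y
    leaves-independent ((lx , x≢h₁ , x≢h₂) , h₁~x) y-leaf@((ly , y≢h₁ , y≢h₂) , _) x~y =
      no-C₄ (_ , _ , _ , _ ,
        cycle₄ lx lh₁ lh₂ ly x≢h₂ (≢-sym y≢h₁) (~-sym h₁~x) h₁~h₂ (leaf₂-attached y-leaf) (~-sym x~y))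

    labelled : ∀ {a b} → (Fin a → Fin n) → (Fin b → Fin n) → DSV a b → Fin n
    labelled e₁ e₂ c₁ = h₁
    labelled e₁ e₂ c₂ = h₂
    labelled e₁ e₂ (l₁ i) = e₁ i
    labelled e₁ e₂ (l₂ j) = e₂ j

    labelled-enumerates : ∀ {a b} {e₁ : Fin a → Fin n} {e₂ : Fin b → Fin n} →
      Enumerates Leaf₁ e₁ → Enumerates Leaf₂ e₂ → Enumerates L (labelled e₁ e₂)
    labelled-enumerates {a} {b} {e₁} {e₂} (e₁-inj , leaf₁ , cover₁) (e₂-inj , leaf₂ , cover₂) =
      inj , inL , cover
      where
      φ : DSV a b → Fin n
      φ = labelled e₁ e₂
      inj : Injective _≡_ _≡_ φ
      inj {c₁} {c₁} _ = refl
      inj {c₁} {c₂} h₁≡h₂ = ⊥-elim (~⇒≢ h₁~h₂ h₁≡h₂)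
      inj {c₁} {l₁ j} h₁≡eⱼ = ⊥-elim (≢h₁ (proj₁ (leaf₁ j)) (sym h₁≡eⱼ))
      inj {c₁} {l₂ j} h₁≡eⱼ = ⊥-elim (≢h₁ (proj₁ (leaf₂ j)) (sym h₁≡eⱼ))
      inj {c₂} {c₁} h₂≡h₁ = ⊥-elim (~⇒≢ h₁~h₂ (sym h₂≡h₁))
      inj {c₂} {c₂} _ = refl
      inj {c₂} {l₁ j} h₂≡eⱼ = ⊥-elim (≢h₂ (proj₁ (leaf₁ j)) (sym h₂≡eⱼ))
      inj {c₂} {l₂ j} h₂≡eⱼ = ⊥-elim (≢h₂ (proj₁ (leaf₂ j)) (sym h₂≡eⱼ))
      inj {l₁ i} {c₁} eᵢ≡h₁ = ⊥-elim (≢h₁ (proj₁ (leaf₁ i)) eᵢ≡h₁)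
      inj {l₁ i} {c₂} eᵢ≡h₂ = ⊥-elim (≢h₂ (proj₁ (leaf₁ i)) eᵢ≡h₂)
      inj {l₁ i} {l₁ j} eᵢ≡eⱼ = cong l₁ (e₁-inj eᵢ≡eⱼ)
      inj {l₁ i} {l₂ j} eᵢ≡eⱼ = ⊥-elim (separated (proj₂ (leaf₁ i)) (proj₂ (leaf₂ j)) eᵢ≡eⱼ)
      inj {l₂ i} {c₁} eᵢ≡h₁ = ⊥-elim (≢h₁ (proj₁ (leaf₂ i)) eᵢ≡h₁)
      inj {l₂ i} {c₂} eᵢ≡h₂ = ⊥-elim (≢h₂ (proj₁ (leaf₂ i)) eᵢ≡h₂)
      inj {l₂ i} {l₁ j} eᵢ≡eⱼ = ⊥-elim (separated (proj₂ (leaf₁ j)) (proj₂ (leaf₂ i)) (sym eᵢ≡eⱼ))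
      inj {l₂ i} {l₂ j} eᵢ≡eⱼ = cong l₂ (e₂-inj eᵢ≡eⱼ)
      inL : ∀ x → L (φ x)
      inL c₁ = lh₁
      inL c₂ = lh₂
      inL (l₁ i) = proj₁ (proj₁ (leaf₁ i))
      inL (l₂ j) = proj₁ (proj₁ (leaf₂ j))
      cover : ∀ v → L v → ∃ λ x → φ x ≡ v
      cover v lv with v ≟ h₁ | v ≟ h₂ | ~-dec h₁ v
      ... | yes refl | _ | _ = c₁ , refl
      ... | no _ | yes refl | _ = c₂ , refl
      ... | no v≢h₁ | no v≢h₂ | yes h₁~v with cover₁ v ((lv , v≢h₁ , v≢h₂) , h₁~v)
      ...   | i , eᵢ≡v = l₁ i , eᵢ≡v
      cover v lv | no v≢h₁ | no v≢h₂ | no h₁≁v with cover₂ v ((lv , v≢h₁ , v≢h₂) , h₁≁v)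
      ...   | j , eⱼ≡v = l₂ j , eⱼ≡v

    labelled-agrees : ∀ {a b} {e₁ : Fin a → Fin n} {e₂ : Fin b → Fin n} →
      (∀ i → Leaf₁ (e₁ i)) → (∀ j → Leaf₂ (e₂ j)) →
      ∀ x y → labelled e₁ e₂ x ~ labelled e₁ e₂ y ⇔ DSAdj a b x y
    labelled-agrees leaf₁ leaf₂ c₁ c₁ = absent ~-irr λ ()
    labelled-agrees leaf₁ leaf₂ c₁ c₂ = holds h₁~h₂ tt
    labelled-agrees leaf₁ leaf₂ c₁ (l₁ j) = holds (proj₂ (leaf₁ j)) tt
    labelled-agrees leaf₁ leaf₂ c₁ (l₂ j) = absent (proj₂ (leaf₂ j)) λ ()
    labelled-agrees leaf₁ leaf₂ c₂ c₁ = holds (~-sym h₁~h₂) tt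
    labelled-agrees leaf₁ leaf₂ c₂ c₂ = absent ~-irr λ ()
    labelled-agrees leaf₁ leaf₂ c₂ (l₁ j) = absent (leaf₁-detached (leaf₁ j)) λ ()
    labelled-agrees leaf₁ leaf₂ c₂ (l₂ j) = holds (leaf₂-attached (leaf₂ j)) tt
    labelled-agrees leaf₁ leaf₂ (l₁ i) c₁ = holds (~-sym (proj₂ (leaf₁ i))) tt
    labelled-agrees leaf₁ leaf₂ (l₁ i) c₂ = absent (leaf₁-detached (leaf₁ i) ∘ ~-sym) λ ()
    labelled-agrees leaf₁ leaf₂ (l₁ i) (l₁ j) = absent (leaves₁-independent (leaf₁ i) (leaf₁ j)) λ ()
    labelled-agrees leaf₁ leaf₂ (l₁ i) (l₂ j) = absent (leaves-independent (leaf₁ i) (leaf₂ j)) λ ()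
    labelled-agrees leaf₁ leaf₂ (l₂ i) c₁ = absent (proj₂ (leaf₂ i) ∘ ~-sym) λ ()
    labelled-agrees leaf₁ leaf₂ (l₂ i) c₂ = holds (~-sym (leaf₂-attached (leaf₂ i))) tt
    labelled-agrees leaf₁ leaf₂ (l₂ i) (l₁ j) = absent (leaves-independent (leaf₁ j) (leaf₂ i) ∘ ~-sym) λ ()
    labelled-agrees leaf₁ leaf₂ (l₂ i) (l₂ j) = absent (leaves₂-independent (leaf₂ i) (leaf₂ j)) λ ()

    double-star : ∃ λ a → ∃ λ b → 1 ≤ a × 1 ≤ b × InducedIso G L (DSV a b) (DSAdj a b)
    double-star with enumerate leaf₁? | enumerate leaf₂? | leaf₁-witness | leaf₂-witness
    ... | a , e₁ , enum₁@(_ , leaf₁ , cover₁) | b , e₂ , enum₂@(_ , leaf₂ , cover₂)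
        | z , z-leaf , _ | w , w-leaf =
      a , b , m<n⇒0<n (toℕ<n (proj₁ (cover₁ z z-leaf))) , m<n⇒0<n (toℕ<n (proj₁ (cover₂ w w-leaf))) ,
      inducedIso (labelled e₁ e₂) (labelled-enumerates enum₁ enum₂) (labelled-agrees leaf₁ leaf₂)

  double-star-case : ¬ Has-C₄ → (∀ c → L c → ¬ Dominating c) →
    ∃ λ a → ∃ λ b → 1 ≤ a × 1 ≤ b × InducedIso G L (DSV a b) (DSAdj a b)
  double-star-case no-C₄ none with dominating-edge none
  ... | _ , _ , lh₁ , lh₂ , h₁~h₂ , dominated =
    DoubleStar.double-star lh₁ lh₂ h₁~h₂ dominated no-C₄ none

  classify : Shapes G L
  classify with has-C₄?
  ... | yes (_ , _ , _ , _ , C) = cycle-case C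
  ... | no no-C₄ with any? (λ c → L? c ×-dec dominating? c)
  ...   | no none = inj₂ (inj₁ (double-star-case no-C₄ λ c lc dom → none (c , lc , dom)))
  ...   | yes (c , lc , dom) with leaf-edge? c
  ...     | no no-edge = inj₁ (star-case lc dom no-edge)
  ...     | yes (_ , _ , p-leaf , q-leaf , p~q) = inj₂ (inj₂ (inj₁ (S1-case no-C₄ lc dom p-leaf q-leaf p~q)))

lemma4p5 : ∀ {n} (G : Graph n) → C5⁺Free G → (u : Fin n) (L : VSet n) →
    Decidable L → IsComponent G (Nbhd G u) L →
      (∃ λ r → InducedIso G L (⊤ ⊎ Fin r) (StarAdj r))
    ⊎ (∃ λ a → ∃ λ b → 1 ≤ a × 1 ≤ b × InducedIso G L (DSV a b) (DSAdj a b))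
    ⊎ (∃ λ r → 2 ≤ r × InducedIso G L (⊤ ⊎ Fin r) (S1Adj r))
    ⊎ InducedIso G L (Fin 4) C4Adj
    ⊎ InducedIso G L (Fin 4) C3⁺Adj
    ⊎ InducedIso G L (Fin 4) K4Adj
lemma4p5 G C₅⁺-free u L L? component@((_ , lv₀) , L⊆N , _) =
  Classification.classify G L? lv₀ (component-connected component)
    (P₅-free-⊆ L⊆N (neighbourhood-P₅-free C₅⁺-free u))
  where open GraphProperties G
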